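{- Let $n,m\ge1$ and let $w\mathcal{A}_0\in\mathcal{A}_+(A_{n-1})$ be an $m$-minimal alcove, where $w\in\mathcal{M}(A_{n-1})$ has level vector $(\beta_1,\ldots,\beta_n)$. Write each integer $k$ as $k=r+n\ell$ with $r\in\{0,1,\ldots,n-1\}$ and $\ell\in\mathbb{Z}$. Then $\alpha(w_{[k]})$ corresponds to an $m$-minimal alcove in $\mathcal{A}_+(C_n)$ if and only if one of the following holds: (i) $r=0$ and $-\lfloor\frac{m}{2}\rfloor-\beta_n\le\ell\le\lfloor\frac{m+1}{2}\rfloor-\beta_1$; or (ii) $1\le r\le n-1$ and $-\beta_{n-r}-\lfloor\frac{m}{2}\rfloor\le\ell\le-\beta_{n-r+1}+\lfloor\frac{m-1}{2}\rfloor$.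
   Context: For $N\ge1$, base-level notation w.r.t. $N$: $a=r^{\ell}$ means $a=r+N\ell$ with $r\in\{1,\ldots,N\}$, $\ell\in\mathbb{Z}$. $\widetilde A_{N-1}$ is the group of bijections $w:\mathbb{Z}\to\mathbb{Z}$ with $w(x+N)=w(x)+N$ and $\sum_{i=1}^N w(i)=\binom{N+1}{2}$; $\mathcal{M}(A_{N-1})$ is the set of such $w$ with $w(1)<\cdots<w(N)$. The level vector $(\beta_1,\ldots,\beta_N)$ of $w$ has $\beta_i$ equal to the level of the entry of $[w(1),\ldots,w(N)]$ with base $i$. Dominant alcoves of the affine Shi arrangement of type $A_{N-1}$ are the $w\mathcal{A}_0$, $w\in\mathcal{M}(A_{N-1})$; dominant alcoves of type $C_n$ are identified with those $\bar w\in\mathcal{M}(A_{2n-1})$ whose abacus is balanced (level vector of the form $(\beta_1,\ldots,\beta_n,-\beta_n,\ldots,-\beta_1)$). For a crystallographic root system $\Phi$ and $m\ge1$, the $m$-Shi arrangement consists of the hyperplanes $\{x:\langle x,\alpha\rangle=k\}$, $\alpha\in\Phi^+$, $-m<k\le m$; each of its regions in the dominant chamber contains a unique alcove closest to the origin, its $m$-minimal alcove, and an alcove is called $m$-minimal if it is the $m$-minimal alcove of some dominant region. It is known that $w\mathcal{A}_0$ ($w\in\mathcal{M}(A_{N-1})$) is $m$-minimal in type $A_{N-1}$ iff $\beta_{i+1}-\beta_i\le m$ for $1\le i\le N-1$ and $\beta_1-\beta_N-1\le m$; and that a type $C_n$ dominant alcove (balanced $\bar w\in\mathcal{M}(A_{2n-1})$)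 is $m$-minimal in type $C_n$ iff $\bar w$ is $m$-minimal in type $A_{2n-1}$. The $k$-shift of $w\in\mathcal{M}(A_{n-1})$ is $w_{[k]}=(w(1)+k,\ldots,w(n)+k)$, written w.r.t. $n$ as $[r_1^{a_1},\ldots,r_n^{a_n}]$; its antisymmetric expansion $\alpha(w_{[k]})$ is the element of $\mathcal{M}(A_{2n-1})$ whose base window is the increasing arrangement of the integers $r_i+2na_i$ and $(2n+1-r_i)-2na_i$, $1\le i\le n$. -}

module Defs where

open import Data.Nat as ℕ using (ℕ; zero; suc)
open import Data.Nat.Combinatorics using (_C_)
open import Data.Integer as ℤ using (ℤ; +_; _+_; _-_; -_; _*_; _≤_; _<_; _/ℕ_; _%ℕ_; 0ℤ; 1ℤ)
open import Data.Product using (_×_; Σ; ∃; _,_)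
open import Data.Sum using (_⊎_)
open import Function.Bundles using (_⇔_)
open import Function.Definitions using (Bijective)
open import Relation.Binary.PropositionalEquality using (_≡_)

-- Euclidean remainder / quotient of an integer by N (N ≥ 1); junk value for N = 0.
remN : ℕ → ℤ → ℕ
remN zero    a = 0
remN (suc N) a = a %ℕ suc N

quoN : ℕ → ℤ → ℤ
quoN zero    a = 0ℤ
quoN (suc N) a = a /ℕ suc N

-- base-level notation w.r.t. N : a = r^ℓ means a = r + N ℓ with r ∈ {1,…,N}
base : ℕ → ℤ → ℕ
base N a = suc (remN N (a - 1ℤ))

level : ℕ → ℤ → ℤ
level N a = quoN N (a - 1ℤ)

-- A window is a function on ℕ of which only the values at 1,…,N matter:
-- w i = w(i) for 1 ≤ i ≤ N.
ext : ℕ → (ℕ → ℤ) → ℤ → ℤ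
ext N w x = w (base N x) + (+ N) * level N x

sumTo : (ℕ → ℤ) → ℕ → ℤ
sumTo f zero    = 0ℤ
sumTo f (suc N) = sumTo f N + f (suc N)

InAffineA : ℕ → (ℕ → ℤ) → Set
InAffineA N w = Bijective _≡_ _≡_ (ext N w) × sumTo w N ≡ + (suc N C 2)

InM : ℕ → (ℕ → ℤ) → Set
InM N w = InAffineA N w × (∀ i → 1 ℕ.≤ i → i ℕ.< N → w i < w (suc i))

-- β is the level vector of w: β_i = level of the window entry with base i
-- (β is 1-indexed; only β 1, …, β N matter)
LevelVector : ℕ → (ℕ → ℤ) → (ℕ → ℤ) → Set
LevelVector N w β = ∀ j → 1 ℕ.≤ j → j ℕ.≤ N → β (base N (w j)) ≡ level N (w j)

MinimalCond : ℕ → ℕ → (ℕ → ℤ) → Set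
MinimalCond N m β =
  (∀ i → 1 ℕ.≤ i → i ℕ.< N → β (suc i) - β i ≤ + m) × (β 1 - β N - 1ℤ ≤ + m)

MMinimalA : ℕ → ℕ → (ℕ → ℤ) → Set
MMinimalA N m w = InM N w × (∀ β → LevelVector N w β → MinimalCond N m β)

Balanced : ℕ → (ℕ → ℤ) → Set
Balanced n w̄ = ∀ β → LevelVector (2 ℕ.* n) w̄ β →
  ∀ i → 1 ℕ.≤ i → i ℕ.≤ n → β (2 ℕ.* n ℕ.+ 1 ℕ.∸ i) ≡ - β i

-- w̄ ∈ M(A_{2n-1}) corresponds to an m-minimal dominant alcove of type C_n:
-- w̄ is balanced and m-minimal in type A_{2n-1}
MMinimalC : ℕ → ℕ → (ℕ → ℤ) → Set
MMinimalC n m w̄ = Balanced n w̄ × MMinimalA (2 ℕ.* n) m w̄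

IsAntisymExp : ℕ → (ℕ → ℤ) → ℤ → (ℕ → ℤ) → Set
IsAntisymExp n w k w̄ =
  (∀ j → 1 ℕ.≤ j → j ℕ.< 2 ℕ.* n → w̄ j < w̄ (suc j)) ×
  (∀ x → (∃ λ j → 1 ℕ.≤ j × j ℕ.≤ 2 ℕ.* n × w̄ j ≡ x) ⇔
         (∃ λ i → 1 ℕ.≤ i × i ℕ.≤ n ×
            (x ≡ + r i + (+ (2 ℕ.* n)) * a i
             ⊎ x ≡ (+ (2 ℕ.* n ℕ.+ 1) - + r i) - (+ (2 ℕ.* n)) * a i)))
  where
    r : ℕ → ℕ
    r i = base n (w i + k)
    a : ℕ → ℤ
    a i = level n (w i + k)

module Submission where

-- Write k = ρ + n ℓ with 0 ≤ ρ < n.  Adding k to the window of w moves an entry of base b and level t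
-- to base b + ρ and level t + ℓ, wrapping around to base b + ρ − n and level t + ℓ + 1 when b + ρ > n;
-- so the level vector A of w_[k] is a rotation of β shifted by ℓ, and every cyclic gap of β (including
-- the wrap-around gap β₁ − β_n − 1) becomes an ordinary gap of A, all bounded by m.
--
-- The window of α(w_[k]) consists of the numbers r_i + 2n a_i and their mirror images
-- 2n+1 − (r_i + 2n a_i), so its bases are exactly 1,…,2n and its level vector is the antisymmetric
-- doubling (A₁,…,A_n,−A_n,…,−A₁) of A.  Hence the abacus is balanced, the periodic extension is a
-- bijection, and since the window is symmetric under j ↦ 2n+1−j its sum is n(2n+1) = (2n+1 choose 2).
-- Of the gap conditions of the doubled vector only two are new: the middle gap −2A_n ≤ m and the
-- wrap-around gap 2A₁ − 1 ≤ m, i.e. −⌊m/2⌋ ≤ A_n and A₁ ≤ ⌊(m+1)/2⌋.  Expressing A_n and A₁ through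
-- β, ρ and ℓ (the cases ρ = 0 and ρ ≥ 1 differ by the wrap-around) gives conditions (i) and (ii).

open import Defs
open import Data.Nat as ℕ using (ℕ; zero; suc; z≤n; s≤s; _/_; _∸_)
import Data.Nat.Properties as ℕP
open import Data.Nat.DivMod using (m*n/n≡m; m/n*n≤m; /-monoˡ-≤; m/n≡1+[m∸n]/n)
open import Data.Nat.Combinatorics using (_C_; nCk+nC[k+1]≡[n+1]C[k+1]; nC1≡n)
import Data.Nat.Tactic.RingSolver as ℕSolver
open import Data.Integer as ℤ using (ℤ; +_; -[1+_]; _+_; _-_; -_; _*_; _≤_; _<_; 0ℤ; 1ℤ; +≤+; -≤+; _/ℕ_; _%ℕ_)
import Data.Integer.Properties as ℤP
open import Data.Integer.DivMod using (a≡a%ℕn+[a/ℕn]*n; n%ℕd<d)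
open import Data.Integer.Tactic.RingSolver using (solve-∀)
open import Algebra.Properties.AbelianGroup ℤP.+-0-abelianGroup using (∙-cancelˡ; ∙-cancelʳ)
open import Data.Product using (_×_; _,_; ∃; proj₁; proj₂)
open import Data.Product.Function.NonDependent.Propositional using (_×-⇔_)
open import Data.Sum using (_⊎_; inj₁; inj₂)
open import Data.Empty using (⊥-elim)
open import Function.Bundles using (_⇔_; mk⇔; Equivalence)
open import Function.Definitions using (Injective; Surjective; Bijective)
open import Function.Properties.Equivalence using () renaming (trans to ⇔-trans)
open import Relation.Nullary using (¬_; yes; no)
open import Relation.Binary.Definitions using (tri<; tri≈; tri>)
open import Relation.Binary.PropositionalEquality

≤-by-equal-difference : ∀ {x y x′ y′ : ℤ} → y - x ≡ y′ - x′ → x ≤ y → x′ ≤ y′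
≤-by-equal-difference e x≤y = ℤP.0≤i-j⇒j≤i (subst (0ℤ ≤_) e (ℤP.i≤j⇒0≤j-i x≤y))

⇔-by-equal-difference : ∀ {x y x′ y′ : ℤ} → y - x ≡ y′ - x′ → (x ≤ y ⇔ x′ ≤ y′)
⇔-by-equal-difference e = mk⇔ (≤-by-equal-difference e) (≤-by-equal-difference (sym e))

double≤⇔≤half : ∀ (x : ℤ) q → (x + x ≤ + q ⇔ x ≤ + (q ℕ./ 2))
double≤⇔≤half -[1+ _ ] q = mk⇔ (λ _ → -≤+) (λ _ → -≤+)
double≤⇔≤half (+ k)    q = mk⇔ (λ { (+≤+ p) → +≤+ (≤half p) }) (λ { (+≤+ p) → +≤+ (double≤ p) })
  where
  open ℕP.≤-Reasoning
  k+k≡k*2 : k ℕ.+ k ≡ k ℕ.* 2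
  k+k≡k*2 = trans (cong (k ℕ.+_) (sym (ℕP.*-identityˡ k))) (ℕP.*-comm 2 k)
  ≤half : k ℕ.+ k ℕ.≤ q → k ℕ.≤ q ℕ./ 2
  ≤half p = begin
    k             ≡⟨ m*n/n≡m k 2 ⟨
    k ℕ.* 2 ℕ./ 2 ≤⟨ /-monoˡ-≤ 2 (subst (ℕ._≤ q) k+k≡k*2 p) ⟩
    q ℕ./ 2       ∎
  double≤ : k ℕ.≤ q ℕ./ 2 → k ℕ.+ k ℕ.≤ q
  double≤ p = begin
    k ℕ.+ k             ≡⟨ k+k≡k*2 ⟩
    k ℕ.* 2             ≤⟨ ℕP.*-monoˡ-≤ 2 p ⟩
    q ℕ./ 2 ℕ.* 2       ≤⟨ m/n*n≤m q 2 ⟩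
    q                   ∎

middle-condition⇔ : ∀ (x : ℤ) m → (- x - x ≤ + m ⇔ - + (m ℕ./ 2) ≤ x)
middle-condition⇔ x m =
  ⇔-trans (double≤⇔≤half (- x) m) (⇔-by-equal-difference (difference x (+ (m ℕ./ 2))))
  where
  difference : ∀ x h → h - - x ≡ x - - h
  difference = solve-∀

wrap-condition⇔ : ∀ (x : ℤ) m → (x - - x - 1ℤ ≤ + m ⇔ x ≤ + ((m ℕ.+ 1) ℕ./ 2))
wrap-condition⇔ x m =
  ⇔-trans (⇔-by-equal-difference difference) (double≤⇔≤half x (m ℕ.+ 1))
  where
  difference : + m - (x - - x - 1ℤ) ≡ + (m ℕ.+ 1) - (x + x)
  difference = trans (rearrange x (+ m)) (cong (_- (x + x)) (sym (ℤP.pos-+ m 1)))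
    where
    rearrange : ∀ x m → m - (x - - x - 1ℤ) ≡ (m + 1ℤ) - (x + x)
    rearrange = solve-∀

base-level-decomposition : ∀ {N} a → a ≡ + base (suc N) a + + suc N * level (suc N) a
base-level-decomposition {N} a = begin
  a                                         ≡⟨ minus-plus a 1ℤ ⟨
  (a - 1ℤ) + 1ℤ                             ≡⟨ cong (_+ 1ℤ) (a≡a%ℕn+[a/ℕn]*n (a - 1ℤ) (suc N)) ⟩
  (+ r + q * + suc N) + 1ℤ                  ≡⟨ rearrange (+ r) q (+ suc N) ⟩
  (1ℤ + + r) + + suc N * q                  ∎
  where
  open ≡-Reasoning
  r : ℕ
  r = (a - 1ℤ) %ℕ suc N
  q : ℤ
  q = (a - 1ℤ) /ℕ suc N
  minus-plus : ∀ a b → (a - b) + b ≡ a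
  minus-plus = solve-∀
  rearrange : ∀ r q n → (r + q * n) + 1ℤ ≡ (1ℤ + r) + n * q
  rearrange = solve-∀

1≤base : ∀ {N} a → 1 ℕ.≤ base (suc N) a
1≤base a = s≤s z≤n

base≤modulus : ∀ {N} a → base (suc N) a ℕ.≤ suc N
base≤modulus {N} a = n%ℕd<d (a - 1ℤ) (suc N)

private
  higher-level-impossible : ∀ {N b c s t} → b ℕ.≤ N → 1 ℕ.≤ c →
                            + b + + N * s ≡ + c + + N * t → ¬ (s < t)
  higher-level-impossible {N} {b} {c} {s} {t} b≤N 1≤c eq s<t =
    ℕP.<-irrefl refl (ℕP.≤-trans (ℕP.+-monoˡ-≤ N 1≤c) (ℕP.≤-trans (ℤP.drop‿+≤+ c+N≤b) b≤N))
    where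
    open ≡-Reasoning
    cancel-c : ∀ c x y → x - y ≡ (c + x) - (c + y)
    cancel-c = solve-∀
    cancel-Ns : ∀ b c n s → (b + n * s) - (c + n * (1ℤ + s)) ≡ b - (c + n)
    cancel-Ns = solve-∀
    difference : + N * t - + N * ℤ.suc s ≡ + b - (+ c + + N)
    difference = begin
      + N * t - + N * ℤ.suc s                  ≡⟨ cancel-c (+ c) (+ N * t) (+ N * ℤ.suc s) ⟩
      (+ c + + N * t) - (+ c + + N * ℤ.suc s)  ≡⟨ cong (_- (+ c + + N * ℤ.suc s)) eq ⟨
      (+ b + + N * s) - (+ c + + N * ℤ.suc s)  ≡⟨ cancel-Ns (+ b) (+ c) (+ N) s ⟩
      + b - (+ c + + N)                        ∎
    c+N≤b : + c + + N ≤ + b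
    c+N≤b = ≤-by-equal-difference difference (ℤP.*-monoˡ-≤-nonNeg (+ N) (ℤP.i<j⇒suc[i]≤j s<t))

bounded-remainder-unique : ∀ {N b c s t} → 1 ℕ.≤ b → b ℕ.≤ N → 1 ℕ.≤ c → c ℕ.≤ N →
                           + b + + N * s ≡ + c + + N * t → b ≡ c × s ≡ t
bounded-remainder-unique {N} {b} {c} {s} {t} 1≤b b≤N 1≤c c≤N eq =
  ℤP.+-injective (∙-cancelʳ (+ N * t) (+ b) (+ c) (subst (λ x → + b + + N * x ≡ _) s≡t eq)) , s≡t
  where
  s≡t : s ≡ t
  s≡t = ℤP.≤-antisym (ℤP.≮⇒≥ (higher-level-impossible c≤N 1≤b (sym eq)))
                     (ℤP.≮⇒≥ (higher-level-impossible b≤N 1≤c eq))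

base-level-unique : ∀ {N c t a} → 1 ℕ.≤ c → c ℕ.≤ suc N → a ≡ + c + + suc N * t →
                    base (suc N) a ≡ c × level (suc N) a ≡ t
base-level-unique {N} {c} {t} 1≤c c≤N refl =
  bounded-remainder-unique (1≤base a) (base≤modulus a) 1≤c c≤N (sym (base-level-decomposition a))
  where
  a : ℤ
  a = + c + + suc N * t

base-level-+-multiple : ∀ {N} a t → base (suc N) (a + + suc N * t) ≡ base (suc N) a
                                   × level (suc N) (a + + suc N * t) ≡ level (suc N) a + t
base-level-+-multiple {N} a t = base-level-unique (1≤base a) (base≤modulus a) (begin
  a + + suc N * t                                          ≡⟨ cong (_+ + suc N * t) (base-level-decomposition a) ⟩
  (+ base (suc N) a + + suc N * level (suc N) a) + + suc N * t ≡⟨ distrib (+ base (suc N) a) (+ suc N) (level (suc N) a) t ⟩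
  + base (suc N) a + + suc N * (level (suc N) a + t)         ∎)
  where
  open ≡-Reasoning
  distrib : ∀ b n l t → (b + n * l) + n * t ≡ b + n * (l + t)
  distrib = solve-∀

ext-normal-form : ∀ {N} (v : ℕ → ℤ) c t → 1 ℕ.≤ c → c ℕ.≤ suc N →
                  ext (suc N) v (+ c + + suc N * t) ≡ v c + + suc N * t
ext-normal-form {N} v c t 1≤c c≤N with base-level-unique {N} {c} {t} 1≤c c≤N refl
... | base≡c , level≡t = cong₂ (λ b l → v b + + suc N * l) base≡c level≡t

-- Periodic extensions of windows

module _ {N : ℕ} (v : ℕ → ℤ) where

  private
    n : ℕ
    n = suc N

  ext-+-constant : ∀ k x → ext n (λ i → v i + k) x ≡ ext n v x + k
  ext-+-constant k x = swap (v (base n x)) k (+ n * level n x)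
    where
    swap : ∀ a k c → (a + k) + c ≡ (a + c) + k
    swap = solve-∀

  ext-+-constant-bijective : ∀ k → Bijective _≡_ _≡_ (ext n v) → Bijective _≡_ _≡_ (ext n (λ i → v i + k))
  ext-+-constant-bijective k (injective , surjective) = injective′ , surjective′
    where
    injective′ : Injective _≡_ _≡_ (ext n (λ i → v i + k))
    injective′ {x} {y} e = injective (∙-cancelʳ k _ _
      (trans (sym (ext-+-constant k x)) (trans e (ext-+-constant k y))))
    surjective′ : Surjective _≡_ _≡_ (ext n (λ i → v i + k))
    surjective′ y with surjective (y - k)
    ... | x , hits = x , λ { refl → trans (ext-+-constant k x) (trans (cong (_+ k) (hits refl)) (minus-plus y k)) }
      where
      minus-plus : ∀ a b → (a - b) + b ≡ a
      minus-plus = solve-∀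

  base-ext : ∀ x → base n (ext n v x) ≡ base n (v (base n x))
  base-ext x = proj₁ (base-level-+-multiple (v (base n x)) (level n x))

  level-ext : ∀ x → level n (ext n v x) ≡ level n (v (base n x)) + level n x
  level-ext x = proj₂ (base-level-+-multiple (v (base n x)) (level n x))

  ext-injective⇒base-injective : Injective _≡_ _≡_ (ext n v) →
    ∀ {i i′} → 1 ℕ.≤ i → i ℕ.≤ n → 1 ℕ.≤ i′ → i′ ℕ.≤ n → base n (v i) ≡ base n (v i′) → i ≡ i′
  ext-injective⇒base-injective injective {i} {i′} 1≤i i≤n 1≤i′ i′≤n same-base =
    proj₁ (bounded-remainder-unique {s = s′} {t = s} 1≤i i≤n 1≤i′ i′≤n (injective (begin
      ext n v (+ i + + n * s′)            ≡⟨ ext-normal-form v i s′ 1≤i i≤n ⟩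
      v i + + n * s′                      ≡⟨ cong (_+ + n * s′) (base-level-decomposition (v i)) ⟩
      (+ base n (v i) + + n * s) + + n * s′  ≡⟨ swap (+ base n (v i)) (+ n) s s′ ⟩
      (+ base n (v i) + + n * s′) + + n * s  ≡⟨ cong (λ b → (+ b + + n * s′) + + n * s) same-base ⟩
      (+ base n (v i′) + + n * s′) + + n * s ≡⟨ cong (_+ + n * s) (base-level-decomposition (v i′)) ⟨
      v i′ + + n * s                      ≡⟨ ext-normal-form v i′ s 1≤i′ i′≤n ⟨
      ext n v (+ i′ + + n * s)            ∎)))
    where
    open ≡-Reasoning
    s s′ : ℤ
    s  = level n (v i)
    s′ = level n (v i′)
    swap : ∀ b n s s′ → (b + n * s) + n * s′ ≡ (b + n * s′) + n * s
    swap = solve-∀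

  ext-surjective⇒base-surjective : Surjective _≡_ _≡_ (ext n v) →
    ∀ b → 1 ℕ.≤ b → b ℕ.≤ n → ∃ λ i → 1 ℕ.≤ i × i ℕ.≤ n × base n (v i) ≡ b
  ext-surjective⇒base-surjective surjective b 1≤b b≤n with surjective (+ b)
  ... | x , hits = base n x , 1≤base x , base≤modulus x , (begin
    base n (v (base n x))                             ≡⟨ base-ext x ⟨
    base n (ext n v x)                                ≡⟨ cong (base n) (hits refl) ⟩
    base n (+ b)                                      ≡⟨ proj₁ (base-level-unique {t = 0ℤ} 1≤b b≤n b≡b+n*0) ⟩
    b                                                 ∎)
    where
    open ≡-Reasoning
    b≡b+n*0 : + b ≡ + b + + n * 0ℤ
    b≡b+n*0 = sym (trans (cong (_+_ (+ b)) (ℤP.*-zeroʳ (+ n))) (ℤP.+-identityʳ (+ b)))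

  base-bijective⇒ext-bijective :
    (∀ {i i′} → 1 ℕ.≤ i → i ℕ.≤ n → 1 ℕ.≤ i′ → i′ ℕ.≤ n → base n (v i) ≡ base n (v i′) → i ≡ i′) →
    (∀ b → 1 ℕ.≤ b → b ℕ.≤ n → ∃ λ i → 1 ℕ.≤ i × i ℕ.≤ n × base n (v i) ≡ b) →
    Bijective _≡_ _≡_ (ext n v)
  base-bijective⇒ext-bijective base-injective base-surjective = injective , surjective
    where
    open ≡-Reasoning
    injective : Injective _≡_ _≡_ (ext n v)
    injective {x} {y} e = begin
      x                             ≡⟨ base-level-decomposition x ⟩
      + base n x + + n * level n x  ≡⟨ cong₂ (λ b l → + b + + n * l) bx≡by lx≡ly ⟩
      + base n y + + n * level n y  ≡⟨ base-level-decomposition y ⟨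
      y                             ∎
      where
      bx≡by : base n x ≡ base n y
      bx≡by = base-injective (1≤base x) (base≤modulus x) (1≤base y) (base≤modulus y)
        (trans (sym (base-ext x)) (trans (cong (base n) e) (base-ext y)))
      lx≡ly : level n x ≡ level n y
      lx≡ly = ∙-cancelˡ (level n (v (base n x))) (level n x) (level n y)
        (trans (sym (level-ext x)) (trans (cong (level n) e)
          (trans (level-ext y) (cong (λ b → level n (v b) + level n y) (sym bx≡by)))))
    surjective : Surjective _≡_ _≡_ (ext n v)
    surjective y with base-surjective (base n y) (1≤base y) (base≤modulus y)
    ... | i , 1≤i , i≤n , base-vi≡base-y = + i + + n * (ly - lvi) , λ { refl → begin
      ext n v (+ i + + n * (ly - lvi))      ≡⟨ ext-normal-form v i (ly - lvi) 1≤i i≤n ⟩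
      v i + + n * (ly - lvi)                ≡⟨ cong (_+ + n * (ly - lvi)) (base-level-decomposition (v i)) ⟩
      (+ base n (v i) + + n * lvi) + + n * (ly - lvi) ≡⟨ cancel (+ base n (v i)) (+ n) lvi ly ⟩
      + base n (v i) + + n * ly             ≡⟨ cong (λ b → + b + + n * ly) base-vi≡base-y ⟩
      + base n y + + n * ly                 ≡⟨ base-level-decomposition y ⟨
      y                                     ∎ }
      where
      ly lvi : ℤ
      ly  = level n y
      lvi = level n (v i)
      cancel : ∀ b n l l′ → (b + n * l) + n * (l′ - l) ≡ b + n * l′
      cancel = solve-∀

sumTo-cong : ∀ {f g} M → (∀ j → 1 ℕ.≤ j → j ℕ.≤ M → f j ≡ g j) → sumTo f M ≡ sumTo g M
sumTo-cong zero    f≡g = refl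
sumTo-cong (suc M) f≡g =
  cong₂ _+_ (sumTo-cong M (λ j 1≤j j≤M → f≡g j 1≤j (ℕP.m≤n⇒m≤1+n j≤M))) (f≡g (suc M) (s≤s z≤n) ℕP.≤-refl)

sumTo-unfoldˡ : ∀ f M → sumTo f (suc M) ≡ f 1 + sumTo (λ j → f (suc j)) M
sumTo-unfoldˡ f zero    = ℤP.+-comm 0ℤ (f 1)
sumTo-unfoldˡ f (suc M) = trans (cong (_+ f (suc (suc M))) (sumTo-unfoldˡ f M)) (ℤP.+-assoc (f 1) _ _)

sumTo-reverse : ∀ f M → sumTo (λ j → f (suc M ∸ j)) M ≡ sumTo f M
sumTo-reverse f zero    = refl
sumTo-reverse f (suc M) = begin
  sumTo (λ j → f (suc (suc M) ∸ j)) M + f (suc (suc M) ∸ suc M) ≡⟨ cong₂ _+_ shifted (cong f (ℕP.m+n∸n≡m 1 M)) ⟩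
  sumTo (λ j → f (suc j)) M + f 1                               ≡⟨ ℤP.+-comm _ (f 1) ⟩
  f 1 + sumTo (λ j → f (suc j)) M                               ≡⟨ sumTo-unfoldˡ f M ⟨
  sumTo f (suc M)                                               ∎
  where
  open ≡-Reasoning
  shifted : sumTo (λ j → f (suc (suc M) ∸ j)) M ≡ sumTo (λ j → f (suc j)) M
  shifted = trans (sumTo-cong M (λ j _ j≤M → cong f (ℕP.+-∸-assoc 1 (ℕP.m≤n⇒m≤1+n j≤M))))
                  (sumTo-reverse (λ j → f (suc j)) M)

sumTo-const-minus : ∀ c f M → sumTo (λ j → c - f j) M ≡ + M * c - sumTo f M
sumTo-const-minus c f zero    = ℤP.+-inverseʳ 0ℤ
sumTo-const-minus c f (suc M) = begin
  sumTo (λ j → c - f j) M + (c - f (suc M)) ≡⟨ cong (_+ (c - f (suc M))) (sumTo-const-minus c f M) ⟩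
  (+ M * c - sumTo f M) + (c - f (suc M))   ≡⟨ collect (+ M) c (sumTo f M) (f (suc M)) ⟩
  (1ℤ + + M) * c - (sumTo f M + f (suc M))  ∎
  where
  open ≡-Reasoning
  collect : ∀ m c s x → (m * c - s) + (c - x) ≡ (1ℤ + m) * c - (s + x)
  collect = solve-∀

sumTo-of-reflection : ∀ {f} c M → (∀ j → 1 ℕ.≤ j → j ℕ.≤ M → f (suc M ∸ j) ≡ c - f j) →
                      sumTo f M + sumTo f M ≡ + M * c
sumTo-of-reflection {f} c M reflect = begin
  sumTo f M + sumTo f M                            ≡⟨ cong (_+ sumTo f M) (sumTo-reverse f M) ⟨
  sumTo (λ j → f (suc M ∸ j)) M + sumTo f M       ≡⟨ cong (_+ sumTo f M) (sumTo-cong M reflect) ⟩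
  sumTo (λ j → c - f j) M + sumTo f M             ≡⟨ cong (_+ sumTo f M) (sumTo-const-minus c f M) ⟩
  (+ M * c - sumTo f M) + sumTo f M               ≡⟨ minus-plus (+ M * c) (sumTo f M) ⟩
  + M * c                                         ∎
  where
  open ≡-Reasoning
  minus-plus : ∀ a b → (a - b) + b ≡ a
  minus-plus = solve-∀

2*[1+n]C2≡[1+n]*n : ∀ n → 2 ℕ.* (suc n C 2) ≡ suc n ℕ.* n
2*[1+n]C2≡[1+n]*n zero    = refl
2*[1+n]C2≡[1+n]*n (suc n) = begin
  2 ℕ.* (suc (suc n) C 2)                 ≡⟨ cong (2 ℕ.*_) (nCk+nC[k+1]≡[n+1]C[k+1] (suc n) 1) ⟨
  2 ℕ.* (suc n C 1 ℕ.+ suc n C 2)         ≡⟨ cong (λ x → 2 ℕ.* (x ℕ.+ suc n C 2)) (nC1≡n (suc n)) ⟩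
  2 ℕ.* (suc n ℕ.+ suc n C 2)             ≡⟨ ℕP.*-distribˡ-+ 2 (suc n) (suc n C 2) ⟩
  2 ℕ.* suc n ℕ.+ 2 ℕ.* (suc n C 2)       ≡⟨ cong (2 ℕ.* suc n ℕ.+_) (2*[1+n]C2≡[1+n]*n n) ⟩
  2 ℕ.* suc n ℕ.+ suc n ℕ.* n             ≡⟨ factor n ⟩
  suc (suc n) ℕ.* suc n                   ∎
  where
  open ≡-Reasoning
  factor : ∀ n → 2 ℕ.* suc n ℕ.+ suc n ℕ.* n ≡ suc (suc n) ℕ.* suc n
  factor = ℕSolver.solve-∀

-- Increasing enumerations

StrictlyIncreasingOn : ℕ → (ℕ → ℤ) → Set
StrictlyIncreasingOn M f = ∀ j → 1 ℕ.≤ j → j ℕ.< M → f j < f (suc j)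

ValuesAmong : ℕ → (ℕ → ℤ) → (ℕ → ℤ) → Set
ValuesAmong M f g = ∀ j → 1 ℕ.≤ j → j ℕ.≤ M → ∃ λ q → 1 ℕ.≤ q × q ℕ.≤ M × f j ≡ g q

module _ {M f} (f-incr : StrictlyIncreasingOn M f) where

  increasing-< : ∀ {p q} → 1 ℕ.≤ p → p ℕ.< q → q ℕ.≤ M → f p < f q
  increasing-< {p} {suc q} 1≤p (s≤s p≤q) q<M with ℕP.m≤n⇒m<n∨m≡n p≤q
  ... | inj₂ refl = f-incr p 1≤p q<M
  ... | inj₁ p<q  = ℤP.<-trans (increasing-< 1≤p p<q (ℕP.<⇒≤ q<M))
                                (f-incr q (ℕP.≤-trans 1≤p (ℕP.<⇒≤ p<q)) q<M)

  increasing-≤ : ∀ {p q} → 1 ℕ.≤ p → p ℕ.≤ q → q ℕ.≤ M → f p ≤ f q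
  increasing-≤ 1≤p p≤q q≤M with ℕP.m≤n⇒m<n∨m≡n p≤q
  ... | inj₂ refl = ℤP.≤-refl
  ... | inj₁ p<q  = ℤP.<⇒≤ (increasing-< 1≤p p<q q≤M)

  increasing-injective : ∀ {p q} → 1 ℕ.≤ p → p ℕ.≤ M → 1 ℕ.≤ q → q ℕ.≤ M → f p ≡ f q → p ≡ q
  increasing-injective {p} {q} 1≤p p≤M 1≤q q≤M fp≡fq with ℕP.<-cmp p q
  ... | tri< p<q _ _ = ⊥-elim (ℤP.<-irrefl fp≡fq (increasing-< 1≤p p<q q≤M))
  ... | tri≈ _ p≡q _ = p≡q
  ... | tri> _ _ q<p = ⊥-elim (ℤP.<-irrefl (sym fp≡fq) (increasing-< 1≤q q<p p≤M))

private
  next-value-≥ : ∀ {M f g} → StrictlyIncreasingOn M f → StrictlyIncreasingOn M g → ValuesAmong M f g →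
                 ∀ j → suc j ℕ.≤ M → (1 ℕ.≤ j → f j ≡ g j) → g (suc j) ≤ f (suc j)
  next-value-≥ {M} {f} {g} f-incr g-incr f⊆g j 1+j≤M agree with f⊆g (suc j) (s≤s z≤n) 1+j≤M
  ... | q , 1≤q , q≤M , f[1+j]≡gq with j ℕ.<? q
  ...   | yes j<q = ℤP.≤-trans (increasing-≤ g-incr (s≤s z≤n) j<q q≤M) (ℤP.≤-reflexive (sym f[1+j]≡gq))
  ...   | no  j≮q = ⊥-elim (ℤP.<-irrefl refl gq<gq)
    where
    open ℤP.≤-Reasoning
    q≤j : q ℕ.≤ j
    q≤j = ℕP.≮⇒≥ j≮q
    1≤j : 1 ℕ.≤ j
    1≤j = ℕP.≤-trans 1≤q q≤j
    gq<gq : g q < g q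
    gq<gq = begin-strict
      g q       ≤⟨ increasing-≤ g-incr 1≤q q≤j (ℕP.<⇒≤ 1+j≤M) ⟩
      g j       ≡⟨ agree 1≤j ⟨
      f j       <⟨ f-incr j 1≤j 1+j≤M ⟩
      f (suc j) ≡⟨ f[1+j]≡gq ⟩
      g q       ∎

increasing-enumerations-agree : ∀ {M f g} → StrictlyIncreasingOn M f → StrictlyIncreasingOn M g →
                                ValuesAmong M f g → ValuesAmong M g f →
                                ∀ j → 1 ℕ.≤ j → j ℕ.≤ M → f j ≡ g j
increasing-enumerations-agree {f = f} {g} f-incr g-incr f⊆g g⊆f (suc j) _ 1+j≤M =
  ℤP.≤-antisym (next-value-≥ g-incr f-incr g⊆f j 1+j≤M (λ 1≤j → sym (agree 1≤j)))
               (next-value-≥ f-incr g-incr f⊆g j 1+j≤M agree)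
  where
  agree : 1 ℕ.≤ j → f j ≡ g j
  agree 1≤j = increasing-enumerations-agree f-incr g-incr f⊆g g⊆f j 1≤j (ℕP.<⇒≤ 1+j≤M)

levelVectors-agree : ∀ {N w β β′} →
                     (∀ b → 1 ℕ.≤ b → b ℕ.≤ N → ∃ λ j → 1 ℕ.≤ j × j ℕ.≤ N × base N (w j) ≡ b) →
                     LevelVector N w β → LevelVector N w β′ → ∀ b → 1 ℕ.≤ b → b ℕ.≤ N → β b ≡ β′ b
levelVectors-agree bases-attained β-levels β′-levels b 1≤b b≤N with bases-attained b 1≤b b≤N
... | j , 1≤j , j≤N , refl = trans (β-levels j 1≤j j≤N) (sym (β′-levels j 1≤j j≤N))

GapsAtMost : ℕ → ℕ → (ℕ → ℤ) → Set
GapsAtMost N m β = ∀ i → 1 ℕ.≤ i → i ℕ.< N → β (suc i) - β i ≤ + m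

MinimalCond-cong : ∀ {N m β β′} → 1 ℕ.≤ N → (∀ b → 1 ℕ.≤ b → b ℕ.≤ N → β b ≡ β′ b) →
                   MinimalCond N m β → MinimalCond N m β′
MinimalCond-cong {N} {m} {β} {β′} 1≤N β≡β′ (gaps , wrap) = gaps′ , wrap′
  where
  gaps′ : GapsAtMost N m β′
  gaps′ i 1≤i i<N =
    subst (_≤ + m) (cong₂ _-_ (β≡β′ (suc i) (s≤s z≤n) i<N) (β≡β′ i 1≤i (ℕP.<⇒≤ i<N))) (gaps i 1≤i i<N)
  wrap′ : β′ 1 - β′ N - 1ℤ ≤ + m
  wrap′ = subst (_≤ + m) (cong₂ (λ x y → x - y - 1ℤ) (β≡β′ 1 ℕP.≤-refl 1≤N) (β≡β′ N 1≤N ℕP.≤-refl))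
                wrap

-- The level vector of w_[k] for k = ρ + n ℓ, 0 ≤ ρ < n.
rotatedLevels : ℕ → ℕ → ℤ → (ℕ → ℤ) → ℕ → ℤ
rotatedLevels n ρ ℓ β j with ρ ℕ.<? j
... | yes _ = β (j ∸ ρ) + ℓ
... | no  _ = β (j ℕ.+ n ∸ ρ) + ℓ + 1ℤ

rotatedLevels-> : ∀ {n ρ ℓ β j} → ρ ℕ.< j → rotatedLevels n ρ ℓ β j ≡ β (j ∸ ρ) + ℓ
rotatedLevels-> {ρ = ρ} {j = j} ρ<j with ρ ℕ.<? j
... | yes _   = refl
... | no  ρ≮j = ⊥-elim (ρ≮j ρ<j)

rotatedLevels-≤ : ∀ {n ρ ℓ β j} → j ℕ.≤ ρ → rotatedLevels n ρ ℓ β j ≡ β (j ℕ.+ n ∸ ρ) + ℓ + 1ℤ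
rotatedLevels-≤ {ρ = ρ} {j = j} j≤ρ with ρ ℕ.<? j
... | yes ρ<j = ⊥-elim (ℕP.<⇒≱ ρ<j j≤ρ)
... | no  _   = refl

module _ {N : ℕ} (x k : ℤ) where

  private
    n : ℕ
    n = suc N
    b : ℕ
    b = base n x
    t : ℤ
    t = level n x
    ρ : ℕ
    ρ = remN n k
    ℓ : ℤ
    ℓ = quoN n k

    b+ρ∸n≤ρ : b ℕ.+ ρ ∸ n ℕ.≤ ρ
    b+ρ∸n≤ρ = ℕP.≤-trans (ℕP.∸-monoˡ-≤ n (ℕP.+-monoˡ-≤ ρ (base≤modulus x)))
                         (ℕP.≤-reflexive (ℕP.m+n∸m≡n n ρ))

    sum-decomposition : x + k ≡ + (b ℕ.+ ρ) + + n * (t + ℓ)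
    sum-decomposition =
      trans (cong₂ _+_ (base-level-decomposition x) (a≡a%ℕn+[a/ℕn]*n k n)) (collect (+ b) t (+ ρ) ℓ (+ n))
      where
      collect : ∀ b t ρ ℓ n → (b + n * t) + (ρ + ℓ * n) ≡ (b + ρ) + n * (t + ℓ)
      collect = solve-∀

  base-level-+-no-carry : b ℕ.+ ρ ℕ.≤ n → base n (x + k) ≡ b ℕ.+ ρ × level n (x + k) ≡ t + ℓ
  base-level-+-no-carry b+ρ≤n =
    base-level-unique (ℕP.≤-trans (1≤base x) (ℕP.m≤m+n b ρ)) b+ρ≤n sum-decomposition

  base-level-+-carry : n ℕ.< b ℕ.+ ρ → base n (x + k) ≡ b ℕ.+ ρ ∸ n × level n (x + k) ≡ t + ℓ + 1ℤ
  base-level-+-carry n<b+ρ = base-level-unique 1≤c c≤n (trans sum-decomposition carry)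
    where
    c : ℕ
    c = b ℕ.+ ρ ∸ n
    1≤c : 1 ℕ.≤ c
    1≤c = ℕP.m<n⇒0<n∸m n<b+ρ
    c≤n : c ℕ.≤ n
    c≤n = ℕP.≤-trans b+ρ∸n≤ρ (ℕP.<⇒≤ (n%ℕd<d k n))
    move-n : ∀ c n t ℓ → (c + n) + n * (t + ℓ) ≡ c + n * (t + ℓ + 1ℤ)
    move-n = solve-∀
    carry : + (b ℕ.+ ρ) + + n * (t + ℓ) ≡ + c + + n * (t + ℓ + 1ℤ)
    carry = trans (cong (λ y → + y + + n * (t + ℓ)) (sym (ℕP.m∸n+n≡m (ℕP.<⇒≤ n<b+ρ))))
                  (move-n (+ c) (+ n) t ℓ)


  levels-of-shift : ∀ β → β b ≡ t → level n (x + k) ≡ rotatedLevels n ρ ℓ β (base n (x + k))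
  levels-of-shift β βb≡t with b ℕ.+ ρ ℕ.≤? n
  ... | yes no-carry = begin
    level n (x + k)        ≡⟨ proj₂ (base-level-+-no-carry no-carry) ⟩
    t + ℓ                  ≡⟨ cong (_+ ℓ) βb≡t ⟨
    β b + ℓ                ≡⟨ cong (λ j → β j + ℓ) (ℕP.m+n∸n≡m b ρ) ⟨
    β (b ℕ.+ ρ ∸ ρ) + ℓ    ≡⟨ rotatedLevels-> (ℕP.<-≤-trans (ℕP.n<1+n ρ) (ℕP.+-monoˡ-≤ ρ (1≤base x))) ⟨
    A (b ℕ.+ ρ)            ≡⟨ cong A (proj₁ (base-level-+-no-carry no-carry)) ⟨
    A (base n (x + k))     ∎
    where
    open ≡-Reasoning
    A : ℕ → ℤ
    A = rotatedLevels n ρ ℓ β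
  ... | no carry = begin
    level n (x + k)        ≡⟨ proj₂ (base-level-+-carry n<b+ρ) ⟩
    t + ℓ + 1ℤ             ≡⟨ cong (λ l → l + ℓ + 1ℤ) βb≡t ⟨
    β b + ℓ + 1ℤ           ≡⟨ cong (λ j → β j + ℓ + 1ℤ) unwrap ⟨
    β (c ℕ.+ n ∸ ρ) + ℓ + 1ℤ ≡⟨ rotatedLevels-≤ b+ρ∸n≤ρ ⟨
    A c                    ≡⟨ cong A (proj₁ (base-level-+-carry n<b+ρ)) ⟨
    A (base n (x + k))     ∎
    where
    open ≡-Reasoning
    A : ℕ → ℤ
    A = rotatedLevels n ρ ℓ β
    n<b+ρ : n ℕ.< b ℕ.+ ρ
    n<b+ρ = ℕP.≰⇒> carry
    c : ℕ
    c = b ℕ.+ ρ ∸ n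
    unwrap : c ℕ.+ n ∸ ρ ≡ b
    unwrap = trans (cong (_∸ ρ) (ℕP.m∸n+n≡m (ℕP.<⇒≤ n<b+ρ))) (ℕP.m+n∸n≡m b ρ)

module _ {n m ρ : ℕ} {ℓ : ℤ} {β : ℕ → ℤ} where

  private
    A : ℕ → ℤ
    A = rotatedLevels n ρ ℓ β

  rotatedLevels-gaps : ρ ℕ.< n → MinimalCond n m β → GapsAtMost n m A
  rotatedLevels-gaps ρ<n (gaps , wrap) j 1≤j j<n with ℕP.<-cmp ρ j
  ... | tri< ρ<j _ _ =
    subst (_≤ + m) (sym gap≡) (gaps (j ∸ ρ) (ℕP.m<n⇒0<n∸m ρ<j) (ℕP.≤-<-trans (ℕP.m∸n≤m j ρ) j<n))
    where
    cancel : ∀ x y ℓ → (x + ℓ) - (y + ℓ) ≡ x - y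
    cancel = solve-∀
    gap≡ : A (suc j) - A j ≡ β (suc (j ∸ ρ)) - β (j ∸ ρ)
    gap≡ = trans (cong₂ _-_ (trans (rotatedLevels-> (ℕP.m<n⇒m<1+n ρ<j))
                                   (cong (λ i → β i + ℓ) (ℕP.+-∸-assoc 1 (ℕP.<⇒≤ ρ<j))))
                            (rotatedLevels-> ρ<j))
                 (cancel (β (suc (j ∸ ρ))) (β (j ∸ ρ)) ℓ)
  ... | tri≈ _ refl _ = subst (_≤ + m) (sym gap≡) wrap
    where
    cancel : ∀ x y ℓ → (x + ℓ) - (y + ℓ + 1ℤ) ≡ x - y - 1ℤ
    cancel = solve-∀
    gap≡ : A (suc ρ) - A ρ ≡ β 1 - β n - 1ℤ
    gap≡ = trans (cong₂ _-_ (trans (rotatedLevels-> (ℕP.n<1+n ρ)) (cong (λ i → β i + ℓ) (ℕP.m+n∸n≡m 1 ρ)))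
                            (trans (rotatedLevels-≤ {n} {ρ} {ℓ} {β} ℕP.≤-refl)
                                   (cong (λ i → β i + ℓ + 1ℤ) (ℕP.m+n∸m≡n ρ n))))
                 (cancel (β 1) (β n) ℓ)
  ... | tri> _ _ j<ρ = subst (_≤ + m) (sym gap≡) (gaps i 1≤i i<n)
    where
    i : ℕ
    i = j ℕ.+ n ∸ ρ
    ρ≤j+n : ρ ℕ.≤ j ℕ.+ n
    ρ≤j+n = ℕP.≤-trans (ℕP.<⇒≤ ρ<n) (ℕP.m≤n+m n j)
    1≤i : 1 ℕ.≤ i
    1≤i = ℕP.m<n⇒0<n∸m (ℕP.<-≤-trans ρ<n (ℕP.m≤n+m n j))
    i<n : i ℕ.< n
    i<n = ℕP.<-≤-trans (ℕP.∸-monoˡ-< (ℕP.+-monoˡ-< n j<ρ) ρ≤j+n) (ℕP.≤-reflexive (ℕP.m+n∸m≡n ρ n))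
    cancel : ∀ x y ℓ → (x + ℓ + 1ℤ) - (y + ℓ + 1ℤ) ≡ x - y
    cancel = solve-∀
    gap≡ : A (suc j) - A j ≡ β (suc i) - β i
    gap≡ = trans (cong₂ _-_ (trans (rotatedLevels-≤ j<ρ) (cong (λ i → β i + ℓ + 1ℤ) (ℕP.+-∸-assoc 1 ρ≤j+n)))
                            (rotatedLevels-≤ (ℕP.<⇒≤ j<ρ)))
                 (cancel (β (suc i)) (β i) ℓ)

-- Antisymmetric doubling

module _ (n : ℕ) where

  2n≡n+n : 2 ℕ.* n ≡ n ℕ.+ n
  2n≡n+n = cong (n ℕ.+_) (ℕP.+-identityʳ n)

  2n+1∸[1+n]≡n : 2 ℕ.* n ℕ.+ 1 ∸ suc n ≡ n
  2n+1∸[1+n]≡n = trans (cong (_∸ suc n) (ℕP.+-comm (2 ℕ.* n) 1)) (trans (cong (_∸ n) 2n≡n+n) (ℕP.m+n∸m≡n n n))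

  2n+1∸j≤2n : ∀ {j} → 1 ℕ.≤ j → 2 ℕ.* n ℕ.+ 1 ∸ j ℕ.≤ 2 ℕ.* n
  2n+1∸j≤2n 1≤j =
    ℕP.≤-trans (ℕP.∸-monoʳ-≤ (2 ℕ.* n ℕ.+ 1) 1≤j) (ℕP.≤-reflexive (ℕP.m+n∸n≡m (2 ℕ.* n) 1))

  1≤2n+1∸j : ∀ {j} → j ℕ.≤ 2 ℕ.* n → 1 ℕ.≤ 2 ℕ.* n ℕ.+ 1 ∸ j
  1≤2n+1∸j j≤2n = ℕP.m<n⇒0<n∸m (ℕP.≤-<-trans j≤2n (ℕP.≤-reflexive (ℕP.+-comm 1 (2 ℕ.* n))))

  2n+1∸n≡1+n : 2 ℕ.* n ℕ.+ 1 ∸ n ≡ suc n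
  2n+1∸n≡1+n = begin
    2 ℕ.* n ℕ.+ 1 ∸ n    ≡⟨ ℕP.+-∸-comm 1 (ℕP.m≤m+n n (n ℕ.+ 0)) ⟩
    2 ℕ.* n ∸ n ℕ.+ 1    ≡⟨ cong (λ x → x ∸ n ℕ.+ 1) 2n≡n+n ⟩
    n ℕ.+ n ∸ n ℕ.+ 1    ≡⟨ cong (ℕ._+ 1) (ℕP.m+n∸m≡n n n) ⟩
    n ℕ.+ 1              ≡⟨ ℕP.+-comm n 1 ⟩
    suc n                ∎
    where open ≡-Reasoning

  n<2n+1∸j : ∀ {j} → j ℕ.≤ n → n ℕ.< 2 ℕ.* n ℕ.+ 1 ∸ j
  n<2n+1∸j j≤n = ℕP.≤-trans (ℕP.≤-reflexive (sym 2n+1∸n≡1+n)) (ℕP.∸-monoʳ-≤ (2 ℕ.* n ℕ.+ 1) j≤n)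

  2n+1∸j≤n : ∀ {j} → n ℕ.< j → 2 ℕ.* n ℕ.+ 1 ∸ j ℕ.≤ n
  2n+1∸j≤n n<j = ℕP.≤-trans (ℕP.∸-monoʳ-≤ (2 ℕ.* n ℕ.+ 1) n<j) (ℕP.≤-reflexive 2n+1∸[1+n]≡n)

  2n+1∸[2n+1∸j]≡j : ∀ {j} → j ℕ.≤ 2 ℕ.* n → 2 ℕ.* n ℕ.+ 1 ∸ (2 ℕ.* n ℕ.+ 1 ∸ j) ≡ j
  2n+1∸[2n+1∸j]≡j j≤2n = ℕP.m∸[m∸n]≡n (ℕP.≤-trans j≤2n (ℕP.m≤m+n (2 ℕ.* n) 1))

MiddleAndWrapGapsAtMost : ℕ → ℕ → (ℕ → ℤ) → Set
MiddleAndWrapGapsAtMost n m A = - A n - A n ≤ + m × A 1 - - A 1 - 1ℤ ≤ + m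

antisymmetricDoubling : ℕ → (ℕ → ℤ) → ℕ → ℤ
antisymmetricDoubling n A j with j ℕ.≤? n
... | yes _ = A j
... | no  _ = - A (2 ℕ.* n ℕ.+ 1 ∸ j)

module _ {n : ℕ} {A : ℕ → ℤ} where

  private
    D : ℕ → ℤ
    D = antisymmetricDoubling n A

  doubling-≤ : ∀ {j} → j ℕ.≤ n → D j ≡ A j
  doubling-≤ {j} j≤n with j ℕ.≤? n
  ... | yes _   = refl
  ... | no  j≰n = ⊥-elim (j≰n j≤n)

  doubling-> : ∀ {j} → n ℕ.< j → D j ≡ - A (2 ℕ.* n ℕ.+ 1 ∸ j)
  doubling-> {j} n<j with j ℕ.≤? n
  ... | yes j≤n = ⊥-elim (ℕP.<⇒≱ n<j j≤n)
  ... | no  _   = refl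

  doubling-reflect : ∀ {j} → 1 ℕ.≤ j → j ℕ.≤ n → D (2 ℕ.* n ℕ.+ 1 ∸ j) ≡ - D j
  doubling-reflect 1≤j j≤n = trans (doubling-> (n<2n+1∸j n j≤n))
    (cong -_ (trans (cong A (2n+1∸[2n+1∸j]≡j n (ℕP.≤-trans j≤n (ℕP.m≤m+n n (n ℕ.+ 0))))) (sym (doubling-≤ j≤n))))

  doubling-minimal⇔ : ∀ {m} → 1 ℕ.≤ n → GapsAtMost n m A →
    MinimalCond (2 ℕ.* n) m D ⇔ MiddleAndWrapGapsAtMost n m A
  doubling-minimal⇔ {m} 1≤n gaps = mk⇔
    (λ (gaps′ , wrap′) → subst (_≤ + m) middle-gap (gaps′ n 1≤n n<2n) , subst (_≤ + m) wrap≡ wrap′)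
    (λ (middle , wrap) → gaps′ middle , subst (_≤ + m) (sym wrap≡) wrap)
    where
    n<2n : n ℕ.< 2 ℕ.* n
    n<2n = ℕP.m<m+n n (ℕP.≤-trans 1≤n (ℕP.m≤m+n n 0))
    middle-gap : D (suc n) - D n ≡ - A n - A n
    middle-gap = cong₂ _-_ (trans (doubling-> ℕP.≤-refl) (cong (λ i → - A i) (2n+1∸[1+n]≡n n))) (doubling-≤ ℕP.≤-refl)
    wrap≡ : D 1 - D (2 ℕ.* n) - 1ℤ ≡ A 1 - - A 1 - 1ℤ
    wrap≡ = cong₂ (λ x y → x - y - 1ℤ) (doubling-≤ 1≤n)
                  (trans (doubling-> n<2n) (cong (λ i → - A i) (ℕP.m+n∸m≡n (2 ℕ.* n) 1)))
    gaps′ : - A n - A n ≤ + m → GapsAtMost (2 ℕ.* n) m D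
    gaps′ middle j 1≤j j<2n with ℕP.<-cmp j n
    ... | tri< j<n _ _ = subst (_≤ + m) (sym (cong₂ _-_ (doubling-≤ j<n) (doubling-≤ (ℕP.<⇒≤ j<n)))) (gaps j 1≤j j<n)
    ... | tri≈ _ refl _ = subst (_≤ + m) (sym middle-gap) middle
    ... | tri> _ _ n<j = subst (_≤ + m) (sym reflected-gap) (gaps t 1≤t t<n)
      where
      t : ℕ
      t = 2 ℕ.* n ∸ j
      1≤t : 1 ℕ.≤ t
      1≤t = ℕP.m<n⇒0<n∸m j<2n
      t<n : t ℕ.< n
      t<n = ℕP.<-≤-trans (ℕP.∸-monoʳ-< n<j (ℕP.<⇒≤ j<2n))
                         (ℕP.≤-reflexive (trans (cong (_∸ n) (2n≡n+n n)) (ℕP.m+n∸m≡n n n)))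
      negate-swap : ∀ x y → - x - - y ≡ y - x
      negate-swap = solve-∀
      reflected-gap : D (suc j) - D j ≡ A (suc t) - A t
      reflected-gap = trans
        (cong₂ _-_ (trans (doubling-> (ℕP.m<n⇒m<1+n n<j)) (cong (λ i → - A i) (cong (_∸ suc j) (ℕP.+-comm (2 ℕ.* n) 1))))
                   (trans (doubling-> n<j) (cong (λ i → - A i) (trans (ℕP.+-∸-comm 1 (ℕP.<⇒≤ j<2n)) (ℕP.+-comm t 1)))))
        (negate-swap (A t) (A (suc t)))

ShiftCriterion : ℕ → ℕ → (ℕ → ℤ) → ℕ → ℤ → Set
ShiftCriterion n m β ρ ℓ =
  (ρ ≡ 0 × - (+ (m ℕ./ 2)) - β n ≤ ℓ × ℓ ≤ + ((m ℕ.+ 1) ℕ./ 2) - β 1)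
  ⊎ (1 ℕ.≤ ρ × ρ ℕ.≤ n ∸ 1 × - β (n ∸ ρ) - + (m ℕ./ 2) ≤ ℓ × ℓ ≤ - β (n ∸ ρ ℕ.+ 1) + + ((m ∸ 1) ℕ./ 2))

[m+1]/2≡1+[m∸1]/2 : ∀ {m} → 1 ℕ.≤ m → (m ℕ.+ 1) ℕ./ 2 ≡ suc ((m ∸ 1) ℕ./ 2)
[m+1]/2≡1+[m∸1]/2 {suc m} _ =
  trans (m/n≡1+[m∸n]/n (s≤s (ℕP.m≤n+m 1 m))) (cong (λ x → suc (x ℕ./ 2)) (ℕP.m+n∸n≡m m 1))

module _ {n m ρ : ℕ} {ℓ : ℤ} {β : ℕ → ℤ} where

  private
    A : ℕ → ℤ
    A = rotatedLevels n ρ ℓ β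

  endpoint-conditions⇔ShiftCriterion : 1 ℕ.≤ m → ρ ℕ.< n →
    MiddleAndWrapGapsAtMost n m A ⇔ ShiftCriterion n m β ρ ℓ
  endpoint-conditions⇔ShiftCriterion 1≤m ρ<n =
    ⇔-trans (middle-condition⇔ (A n) m ×-⇔ wrap-condition⇔ (A 1) m) by-remainder
    where
    h h′ H : ℤ
    h  = + (m ℕ./ 2)
    h′ = + ((m ∸ 1) ℕ./ 2)
    H  = + ((m ℕ.+ 1) ℕ./ 2)
    move-left : ∀ x ℓ h → (x + ℓ) - - h ≡ ℓ - (- h - x)
    move-left = solve-∀
    move-right : ∀ x ℓ h → h - (x + ℓ) ≡ (h - x) - ℓ
    move-right = solve-∀
    move-left′ : ∀ x ℓ h → (x + ℓ) - - h ≡ ℓ - (- x - h)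
    move-left′ = solve-∀
    move-right′ : ∀ x ℓ h → (1ℤ + h) - (x + ℓ + 1ℤ) ≡ (- x + h) - ℓ
    move-right′ = solve-∀
    by-remainder : (- h ≤ A n × A 1 ≤ H) ⇔ ShiftCriterion n m β ρ ℓ
    by-remainder with ρ ℕ.≟ 0
    ... | yes refl = mk⇔ (λ p → inj₁ (refl , Equivalence.to conditions p))
                         (λ { (inj₁ (_ , q)) → Equivalence.from conditions q ; (inj₂ (() , _)) })
      where
      conditions : (- h ≤ A n × A 1 ≤ H) ⇔ (- h - β n ≤ ℓ × ℓ ≤ H - β 1)
      conditions = ⇔-by-equal-difference (trans (cong (_- - h) (rotatedLevels-> {n} {0} {ℓ} {β} ρ<n)) (move-left (β n) ℓ h))
               ×-⇔ ⇔-by-equal-difference (trans (cong (λ x → H - x) (rotatedLevels-> {n} {0} {ℓ} {β} (s≤s z≤n)))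
                                                (move-right (β 1) ℓ H))
    ... | no ρ≢0 = mk⇔ (λ p → inj₂ (1≤ρ , ℕP.∸-monoˡ-≤ 1 ρ<n , Equivalence.to conditions p))
                       (λ { (inj₁ (ρ≡0 , _))     → ⊥-elim (ρ≢0 ρ≡0)
                          ; (inj₂ (_ , _ , q)) → Equivalence.from conditions q })
      where
      1≤ρ : 1 ℕ.≤ ρ
      1≤ρ = ℕP.n≢0⇒n>0 ρ≢0
      A1≡ : A 1 ≡ β (n ∸ ρ ℕ.+ 1) + ℓ + 1ℤ
      A1≡ = trans (rotatedLevels-≤ 1≤ρ)
                  (cong (λ i → β i + ℓ + 1ℤ) (trans (ℕP.+-∸-assoc 1 (ℕP.<⇒≤ ρ<n)) (ℕP.+-comm 1 (n ∸ ρ))))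
      conditions : (- h ≤ A n × A 1 ≤ H) ⇔ (- β (n ∸ ρ) - h ≤ ℓ × ℓ ≤ - β (n ∸ ρ ℕ.+ 1) + h′)
      conditions = ⇔-by-equal-difference (trans (cong (_- - h) (rotatedLevels-> ρ<n)) (move-left′ (β (n ∸ ρ)) ℓ h))
               ×-⇔ ⇔-by-equal-difference (trans (cong₂ _-_ (cong +_ ([m+1]/2≡1+[m∸1]/2 1≤m)) A1≡)
                                                (move-right′ (β (n ∸ ρ ℕ.+ 1)) ℓ h′))

-- The antisymmetric expansion α(w_[k])

module AntisymmetricExpansion {N : ℕ} (w : ℕ → ℤ) (k : ℤ) (w̄ : ℕ → ℤ)
                              (expansion : IsAntisymExp (suc N) w k w̄) where

  n M : ℕ
  n = suc N
  M = 2 ℕ.* n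

  r : ℕ → ℕ
  r i = base n (w i + k)

  a : ℕ → ℤ
  a i = level n (w i + k)

  entry⁺ entry⁻ : ℕ → ℤ
  entry⁺ i = + r i + + M * a i
  entry⁻ i = (+ (M ℕ.+ 1) - + r i) - + M * a i

  private
    r≤M : ∀ i → r i ℕ.≤ M
    r≤M i = ℕP.≤-trans (base≤modulus (w i + k)) (ℕP.m≤m+n n (n ℕ.+ 0))

  base-level-entry⁺ : ∀ i → base M (entry⁺ i) ≡ r i × level M (entry⁺ i) ≡ a i
  base-level-entry⁺ i = base-level-unique (1≤base (w i + k)) (r≤M i) refl

  base-level-entry⁻ : ∀ i → base M (entry⁻ i) ≡ M ℕ.+ 1 ∸ r i × level M (entry⁻ i) ≡ - a i
  base-level-entry⁻ i = base-level-unique (1≤2n+1∸j n (r≤M i)) (2n+1∸j≤2n n (1≤base (w i + k))) (begin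
    (+ (M ℕ.+ 1) - + r i) - + M * a i     ≡⟨ negate-level (+ (M ℕ.+ 1) - + r i) (+ M) (a i) ⟩
    (+ (M ℕ.+ 1) - + r i) + + M * - a i   ≡⟨ cong (_+ + M * - a i) (ℤP.m-n≡m⊖n (M ℕ.+ 1) (r i)) ⟩
    (M ℕ.+ 1) ℤ.⊖ r i + + M * - a i       ≡⟨ cong (_+ + M * - a i) (ℤP.⊖-≥ (ℕP.≤-trans (r≤M i) (ℕP.m≤m+n M 1))) ⟩
    + (M ℕ.+ 1 ∸ r i) + + M * - a i       ∎)
    where
    open ≡-Reasoning
    negate-level : ∀ x m a → x - m * a ≡ x + m * - a
    negate-level = solve-∀

  w̄-increasing : StrictlyIncreasingOn M w̄
  w̄-increasing = proj₁ expansion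

  w̄-entry : ∀ p → 1 ℕ.≤ p → p ℕ.≤ M → ∃ λ i → 1 ℕ.≤ i × i ℕ.≤ n × (w̄ p ≡ entry⁺ i ⊎ w̄ p ≡ entry⁻ i)
  w̄-entry p 1≤p p≤M = Equivalence.to (proj₂ expansion (w̄ p)) (p , 1≤p , p≤M , refl)

  entry⁺-attained : ∀ i → 1 ℕ.≤ i → i ℕ.≤ n → ∃ λ p → 1 ℕ.≤ p × p ℕ.≤ M × w̄ p ≡ entry⁺ i
  entry⁺-attained i 1≤i i≤n = Equivalence.from (proj₂ expansion (entry⁺ i)) (i , 1≤i , i≤n , inj₁ refl)

  entry⁻-attained : ∀ i → 1 ℕ.≤ i → i ℕ.≤ n → ∃ λ p → 1 ℕ.≤ p × p ℕ.≤ M × w̄ p ≡ entry⁻ i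
  entry⁻-attained i 1≤i i≤n = Equivalence.from (proj₂ expansion (entry⁻ i)) (i , 1≤i , i≤n , inj₂ refl)

  private
    base⁺ : ∀ {p i} → w̄ p ≡ entry⁺ i → base M (w̄ p) ≡ r i
    base⁺ {i = i} e = trans (cong (base M) e) (proj₁ (base-level-entry⁺ i))

    base⁻ : ∀ {p i} → w̄ p ≡ entry⁻ i → base M (w̄ p) ≡ M ℕ.+ 1 ∸ r i
    base⁻ {i = i} e = trans (cong (base M) e) (proj₁ (base-level-entry⁻ i))

    X : ℤ
    X = + (M ℕ.+ 1)

    reflected-value-attained : ∀ p → 1 ℕ.≤ p → p ℕ.≤ M → ∃ λ q → 1 ℕ.≤ q × q ℕ.≤ M × X - w̄ p ≡ w̄ q
    reflected-value-attained p 1≤p p≤M with w̄-entry p 1≤p p≤M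
    ... | i , 1≤i , i≤n , inj₁ w̄p≡entry⁺ with entry⁻-attained i 1≤i i≤n
    ...   | q , 1≤q , q≤M , w̄q≡entry⁻ =
            q , 1≤q , q≤M ,
            trans (cong (λ x → X - x) w̄p≡entry⁺) (trans (reflect X (+ r i) (+ M * a i)) (sym w̄q≡entry⁻))
      where
      reflect : ∀ X r y → X - (r + y) ≡ (X - r) - y
      reflect = solve-∀
    reflected-value-attained p 1≤p p≤M | i , 1≤i , i≤n , inj₂ w̄p≡entry⁻ with entry⁺-attained i 1≤i i≤n
    ...   | q , 1≤q , q≤M , w̄q≡entry⁺ =
            q , 1≤q , q≤M ,
            trans (cong (λ x → X - x) w̄p≡entry⁻) (trans (reflect X (+ r i) (+ M * a i)) (sym w̄q≡entry⁺))
      where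
      reflect : ∀ X r y → X - ((X - r) - y) ≡ r + y
      reflect = solve-∀

    reflected : ℕ → ℤ
    reflected j = X - w̄ (M ℕ.+ 1 ∸ j)

    reflected-increasing : StrictlyIncreasingOn M reflected
    reflected-increasing j 1≤j j<M =
      subst₂ (λ u v → X - w̄ u < X - w̄ v) (sym index≡) (sym index′≡)
             (ℤP.+-monoʳ-< X (ℤP.neg-mono-< (w̄-increasing t 1≤t t<M)))
      where
      t : ℕ
      t = M ∸ j
      1≤t : 1 ℕ.≤ t
      1≤t = ℕP.m<n⇒0<n∸m j<M
      t<M : t ℕ.< M
      t<M = ℕP.∸-monoʳ-< 1≤j (ℕP.<⇒≤ j<M)
      index≡ : M ℕ.+ 1 ∸ j ≡ suc t
      index≡ = trans (ℕP.+-∸-comm 1 (ℕP.<⇒≤ j<M)) (ℕP.+-comm t 1)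
      index′≡ : M ℕ.+ 1 ∸ suc j ≡ t
      index′≡ = cong (_∸ suc j) (ℕP.+-comm M 1)

  -- w̄ and j ↦ 2n+1 − w̄(2n+1−j) increasingly enumerate the same set, which is closed under x ↦ 2n+1 − x.
  w̄-reflection : ∀ p → 1 ℕ.≤ p → p ℕ.≤ M → w̄ (M ℕ.+ 1 ∸ p) ≡ + (M ℕ.+ 1) - w̄ p
  w̄-reflection p 1≤p p≤M = trans (sym (flip (w̄ (M ℕ.+ 1 ∸ p)) X)) (cong (λ x → X - x) reflected≡w̄)
    where
    flip : ∀ x y → y - (y - x) ≡ x
    flip = solve-∀
    reflected⊆w̄ : ValuesAmong M reflected w̄
    reflected⊆w̄ j 1≤j j≤M = reflected-value-attained (M ℕ.+ 1 ∸ j) (1≤2n+1∸j n j≤M) (2n+1∸j≤2n n 1≤j)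
    w̄⊆reflected : ValuesAmong M w̄ reflected
    w̄⊆reflected j 1≤j j≤M with reflected-value-attained j 1≤j j≤M
    ... | q , 1≤q , q≤M , X-w̄j≡w̄q = M ℕ.+ 1 ∸ q , 1≤2n+1∸j n q≤M , 2n+1∸j≤2n n 1≤q ,
          trans (sym (flip (w̄ j) X)) (cong (λ x → X - x) (trans X-w̄j≡w̄q (cong w̄ (sym (2n+1∸[2n+1∸j]≡j n q≤M)))))
    reflected≡w̄ : reflected p ≡ w̄ p
    reflected≡w̄ = increasing-enumerations-agree reflected-increasing w̄-increasing reflected⊆w̄ w̄⊆reflected p 1≤p p≤M

  w̄-sum : sumTo w̄ M ≡ + (suc M C 2)
  w̄-sum = ℤP.*-cancelˡ-≡ (+ 2) (sumTo w̄ M) (+ (suc M C 2)) (begin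
    + 2 * sumTo w̄ M             ≡⟨ double (sumTo w̄ M) ⟩
    sumTo w̄ M + sumTo w̄ M       ≡⟨ sumTo-of-reflection X M reflection ⟩
    + M * + (M ℕ.+ 1)           ≡⟨ ℤP.pos-* M (M ℕ.+ 1) ⟨
    + (M ℕ.* (M ℕ.+ 1))         ≡⟨ cong +_ (trans (ℕP.*-comm M (M ℕ.+ 1)) (cong (ℕ._* M) (ℕP.+-comm M 1))) ⟩
    + (suc M ℕ.* M)             ≡⟨ cong +_ (2*[1+n]C2≡[1+n]*n M) ⟨
    + (2 ℕ.* (suc M C 2))       ≡⟨ ℤP.pos-* 2 (suc M C 2) ⟩
    + 2 * + (suc M C 2)         ∎)
    where
    open ≡-Reasoning
    double : ∀ x → + 2 * x ≡ x + x
    double = solve-∀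
    reflection : ∀ j → 1 ℕ.≤ j → j ℕ.≤ M → w̄ (suc M ∸ j) ≡ X - w̄ j
    reflection j 1≤j j≤M = trans (cong (λ i → w̄ (i ∸ j)) (ℕP.+-comm 1 M)) (w̄-reflection j 1≤j j≤M)

  module _ (A : ℕ → ℤ) (A-levels : ∀ i → 1 ℕ.≤ i → i ℕ.≤ n → A (r i) ≡ a i) where

    private
      D : ℕ → ℤ
      D = antisymmetricDoubling n A

    doubling-levelVector : LevelVector M w̄ D
    doubling-levelVector p 1≤p p≤M with w̄-entry p 1≤p p≤M
    ... | i , 1≤i , i≤n , inj₁ e = begin
      D (base M (w̄ p))       ≡⟨ cong D (base⁺ e) ⟩
      D (r i)                ≡⟨ doubling-≤ (base≤modulus (w i + k)) ⟩
      A (r i)                ≡⟨ A-levels i 1≤i i≤n ⟩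
      a i                    ≡⟨ trans (cong (level M) e) (proj₂ (base-level-entry⁺ i)) ⟨
      level M (w̄ p)          ∎
      where open ≡-Reasoning
    ... | i , 1≤i , i≤n , inj₂ e = begin
      D (base M (w̄ p))       ≡⟨ cong D (base⁻ e) ⟩
      D (M ℕ.+ 1 ∸ r i)      ≡⟨ doubling-reflect (1≤base (w i + k)) (base≤modulus (w i + k)) ⟩
      - D (r i)              ≡⟨ cong -_ (doubling-≤ (base≤modulus (w i + k))) ⟩
      - A (r i)              ≡⟨ cong -_ (A-levels i 1≤i i≤n) ⟩
      - a i                  ≡⟨ trans (cong (level M) e) (proj₂ (base-level-entry⁻ i)) ⟨
      level M (w̄ p)          ∎
      where open ≡-Reasoning

  module _ (w-bijective : Bijective _≡_ _≡_ (ext n w)) where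

    private
      shifted-bijective : Bijective _≡_ _≡_ (ext n (λ i → w i + k))
      shifted-bijective = ext-+-constant-bijective w k w-bijective

      r-injective : ∀ {i i′} → 1 ℕ.≤ i → i ℕ.≤ n → 1 ℕ.≤ i′ → i′ ℕ.≤ n → r i ≡ r i′ → i ≡ i′
      r-injective = ext-injective⇒base-injective (λ i → w i + k) (proj₁ shifted-bijective)

      r≤M+1 : ∀ i → r i ℕ.≤ M ℕ.+ 1
      r≤M+1 i = ℕP.≤-trans (r≤M i) (ℕP.m≤m+n M 1)

      r≢M+1∸r : ∀ i i′ → r i ≢ M ℕ.+ 1 ∸ r i′
      r≢M+1∸r i i′ = ℕP.<⇒≢ (ℕP.≤-<-trans (base≤modulus (w i + k)) (n<2n+1∸j n (base≤modulus (w i′ + k))))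

      r-surjective : ∀ b → 1 ℕ.≤ b → b ℕ.≤ n → ∃ λ i → 1 ℕ.≤ i × i ℕ.≤ n × r i ≡ b
      r-surjective = ext-surjective⇒base-surjective (λ i → w i + k) (proj₂ shifted-bijective)

    w̄-base-injective : ∀ {p q} → 1 ℕ.≤ p → p ℕ.≤ M → 1 ℕ.≤ q → q ℕ.≤ M → base M (w̄ p) ≡ base M (w̄ q) → p ≡ q
    w̄-base-injective {p} {q} 1≤p p≤M 1≤q q≤M same-base with w̄-entry p 1≤p p≤M | w̄-entry q 1≤q q≤M
    ... | i , 1≤i , i≤n , inj₁ e | i′ , 1≤i′ , i′≤n , inj₁ e′ =
      increasing-injective w̄-increasing 1≤p p≤M 1≤q q≤M (trans e (trans (cong entry⁺ i≡i′) (sym e′)))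
      where
      i≡i′ : i ≡ i′
      i≡i′ = r-injective 1≤i i≤n 1≤i′ i′≤n (trans (sym (base⁺ e)) (trans same-base (base⁺ e′)))
    ... | i , 1≤i , i≤n , inj₂ e | i′ , 1≤i′ , i′≤n , inj₂ e′ =
      increasing-injective w̄-increasing 1≤p p≤M 1≤q q≤M (trans e (trans (cong entry⁻ i≡i′) (sym e′)))
      where
      i≡i′ : i ≡ i′
      i≡i′ = r-injective 1≤i i≤n 1≤i′ i′≤n
        (ℕP.∸-cancelˡ-≡ (r≤M+1 i) (r≤M+1 i′) (trans (sym (base⁻ e)) (trans same-base (base⁻ e′))))
    ... | i , _ , _ , inj₁ e | i′ , _ , _ , inj₂ e′ =
      ⊥-elim (r≢M+1∸r i i′ (trans (sym (base⁺ e)) (trans same-base (base⁻ e′))))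
    ... | i , _ , _ , inj₂ e | i′ , _ , _ , inj₁ e′ =
      ⊥-elim (r≢M+1∸r i′ i (trans (sym (base⁺ e′)) (trans (sym same-base) (base⁻ e))))

    w̄-base-surjective : ∀ b → 1 ℕ.≤ b → b ℕ.≤ M → ∃ λ p → 1 ℕ.≤ p × p ℕ.≤ M × base M (w̄ p) ≡ b
    w̄-base-surjective b 1≤b b≤M with b ℕ.≤? n
    ... | yes b≤n with r-surjective b 1≤b b≤n
    ...   | i , 1≤i , i≤n , refl with entry⁺-attained i 1≤i i≤n
    ...     | p , 1≤p , p≤M , e = p , 1≤p , p≤M , base⁺ e
    w̄-base-surjective b 1≤b b≤M | no b≰n
      with r-surjective (M ℕ.+ 1 ∸ b) (1≤2n+1∸j n b≤M) (2n+1∸j≤n n (ℕP.≰⇒> b≰n))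
    ... | i , 1≤i , i≤n , ri≡ with entry⁻-attained i 1≤i i≤n
    ...   | p , 1≤p , p≤M , e = p , 1≤p , p≤M ,
            trans (base⁻ e) (trans (cong (M ℕ.+ 1 ∸_) ri≡) (2n+1∸[2n+1∸j]≡j n b≤M))

    w̄∈M : InM M w̄
    w̄∈M = ((base-bijective⇒ext-bijective w̄ w̄-base-injective w̄-base-surjective , w̄-sum) , w̄-increasing)

    module _ (A : ℕ → ℤ) (A-levels : ∀ i → 1 ℕ.≤ i → i ℕ.≤ n → A (r i) ≡ a i) where

      levelVector-of-w̄ : ∀ β̄ → LevelVector M w̄ β̄ →
                         ∀ b → 1 ℕ.≤ b → b ℕ.≤ M → antisymmetricDoubling n A b ≡ β̄ b
      levelVector-of-w̄ β̄ β̄-levels = levelVectors-agree {w = w̄} w̄-base-surjective (doubling-levelVector A A-levels) β̄-levels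

      w̄-balanced : Balanced n w̄
      w̄-balanced β̄ β̄-levels i 1≤i i≤n = begin
        β̄ (M ℕ.+ 1 ∸ i)                       ≡⟨ agree (M ℕ.+ 1 ∸ i) (1≤2n+1∸j n i≤M) (2n+1∸j≤2n n 1≤i) ⟨
        antisymmetricDoubling n A (M ℕ.+ 1 ∸ i) ≡⟨ doubling-reflect 1≤i i≤n ⟩
        - antisymmetricDoubling n A i           ≡⟨ cong -_ (agree i 1≤i i≤M) ⟩
        - β̄ i                                 ∎
        where
        open ≡-Reasoning
        agree : ∀ b → 1 ℕ.≤ b → b ℕ.≤ M → antisymmetricDoubling n A b ≡ β̄ b
        agree = levelVector-of-w̄ β̄ β̄-levels
        i≤M : i ℕ.≤ M
        i≤M = ℕP.≤-trans i≤n (ℕP.m≤m+n n (n ℕ.+ 0))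

      w̄-minimal⇔ : ∀ {m} → GapsAtMost n m A →
                   MMinimalC n m w̄ ⇔ MiddleAndWrapGapsAtMost n m A
      w̄-minimal⇔ {m} gaps = mk⇔
        (λ (_ , _ , minimal) → Equivalence.to doubling⇔ (minimal (antisymmetricDoubling n A) (doubling-levelVector A A-levels)))
        (λ endpoints → w̄-balanced , w̄∈M , λ β̄ β̄-levels →
          MinimalCond-cong (s≤s z≤n) (levelVector-of-w̄ β̄ β̄-levels) (Equivalence.from doubling⇔ endpoints))
        where
        doubling⇔ : MinimalCond M m (antisymmetricDoubling n A) ⇔ MiddleAndWrapGapsAtMost n m A
        doubling⇔ = doubling-minimal⇔ (s≤s z≤n) gaps

proposition2p12 :
    (n m : ℕ) → 1 ℕ.≤ n → 1 ℕ.≤ m →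
    (w : ℕ → ℤ) → MMinimalA n m w →
    (β : ℕ → ℤ) → LevelVector n w β →
    (k : ℤ) → (w̄ : ℕ → ℤ) → IsAntisymExp n w k w̄ →
    (MMinimalC n m w̄ ⇔
      ((remN n k ≡ 0
          × - (+ (m / 2)) - β n ≤ quoN n k
          × quoN n k ≤ + ((m ℕ.+ 1) / 2) - β 1)
       ⊎ (1 ℕ.≤ remN n k × remN n k ℕ.≤ n ∸ 1
          × - β (n ∸ remN n k) - + (m / 2) ≤ quoN n k
          × quoN n k ≤ - β (n ∸ remN n k ℕ.+ 1) + + ((m ∸ 1) / 2))))
proposition2p12 ℕ.zero _ () _ _ _ _ _ _ _
proposition2p12 (suc N) m _ 1≤m w (((w-bijective , _) , _) , w-minimal) β β-levels k w̄ expansion =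
  ⇔-trans (w̄-minimal⇔ w-bijective A A-levels (rotatedLevels-gaps ρ<n (w-minimal β β-levels)))
          (endpoint-conditions⇔ShiftCriterion 1≤m ρ<n)
  where
  open AntisymmetricExpansion w k w̄ expansion
  ρ<n : remN n k ℕ.< n
  ρ<n = n%ℕd<d k n
  A : ℕ → ℤ
  A = rotatedLevels n (remN n k) (quoN n k) β
  A-levels : ∀ i → 1 ℕ.≤ i → i ℕ.≤ n → A (r i) ≡ a i
  A-levels i 1≤i i≤n = sym (levels-of-shift (w i) k β (β-levels i 1≤i i≤n))
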